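{- For every positive integer $d$, $$v_2\left(\binom{4d-1}{2d-1}-(-1)^d\binom{2d-1}{d-1}\right)=2+2v_2(d)+s_2(d-1).$$
   Context: $v_2$ is the $2$-adic valuation and $s_2(m)$ denotes the sum of the binary digits of $m$. -}

module Defs where

open import Data.Nat using (ℕ; zero; suc; _+_; _*_; _^_; _/_; _%_)
open import Data.Integer as ℤ using (ℤ)
open import Data.Integer.Divisibility using () renaming (_∣_ to _∣ℤ_)
open import Relation.Nullary using (¬_)
open import Data.Product using (_×_)

-- binary digit sum with fuel; fuel ≥ m is enough since m / 2 < m for m > 0
s₂-fuel : ℕ → ℕ → ℕ
s₂-fuel zero    m = 0
s₂-fuel (suc f) m = (m % 2) + s₂-fuel f (m / 2)

s₂ : ℕ → ℕ
s₂ m = s₂-fuel m m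

-- x HasV₂ k  :⇔  v₂(x) = k, i.e. 2^k ∣ x and 2^(k+1) ∤ x (forces x ≠ 0)
_HasV₂_ : ℤ → ℕ → Set
x HasV₂ k = (ℤ.+ (2 ^ k) ∣ℤ x) × ¬ (ℤ.+ (2 ^ suc k) ∣ℤ x)

negOnePow : ℕ → ℤ
negOnePow zero    = ℤ.+ 1
negOnePow (suc d) = ℤ.- negOnePow d

-- Let O(d) = 1·3⋯(2d−1) and U(d) = (2d+1)(2d+3)⋯(4d−1). Since (2n)! = 2^n n! O(n),
-- 2·C(2d−1,d−1)·d! = 2^d O(d) and 2·C(4d−1,2d−1)·d! = 2^d U(d); Legendre's formula
-- v₂(d!) = d − s₂(d) and s₂(d) + v₂(d) = s₂(d−1) + 1 then reduce the claim to
-- v₂(U(d) − (−1)^d O(d)) = 2 + 3k, where k = v₂(d).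
-- Pairing factors symmetrically, O(d) and U(d) are products of y² − cᵢ over the same cᵢ,
-- centred at y = d and y = 3d (with an extra middle factor y when d is odd). Expanding in
-- δ = (3d)² − d² = 8d² gives U = O + δe + δ²S up to that middle factor, where e is the sum
-- of the products omitting one factor. For odd d this yields U + O = 4·odd. For d = 2n with
-- n = 2^(k−1)m, e ≡ 2^(k−1) (mod 2^k): doubling the number of factors doubles e modulo the
-- next power of 2, because the second half of the factors agrees with the first one modulo it.
-- Hence v₂(U − O) = v₂(8d²) + k − 1 = 2 + 3k.

module Submission where

open import Data.Product using (Σ-syntax; _×_; _,_; proj₁; proj₂)
open import Data.Empty using (⊥-elim)
open import Relation.Nullary using (¬_)
open import Relation.Binary.PropositionalEquality
open import Defs

module Binary where

  open import Data.Nat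
    using (ℕ; zero; suc; _+_; _*_; _∸_; _^_; _≤_; _<_; _/_; _%_; z≤n; s≤s; NonZero)
  open import Data.Nat.Properties
  open import Data.Nat.DivMod
    using (m*n/n≡m; [m+kn]%n≡m%n; +-distrib-/; m<n⇒m%n≡m; m<n⇒m/n≡0; m/n<m; m*n%n≡0)
  open import Data.Nat.Divisibility
    using (_∣_; divides; ∣-trans; 1∣_; ∣1⇒≡1; ∣m+n∣m⇒∣n; m∣m*n; ∣n⇒∣m*n; *-monoʳ-∣; *-cancelˡ-∣)
  open import Data.Nat.Tactic.RingSolver using (solve-∀)
  open ≡-Reasoning

  data EvenOrOdd : ℕ → Set where
    even : ∀ h → EvenOrOdd (2 * h)
    odd  : ∀ h → EvenOrOdd (1 + 2 * h)

  evenOrOdd : ∀ n → EvenOrOdd n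
  evenOrOdd zero = even 0
  evenOrOdd (suc n) with evenOrOdd n
  ... | even h = odd h
  ... | odd h  = subst EvenOrOdd (*-suc 2 h) (even (suc h))

  Oddℕ : ℕ → Set
  Oddℕ m = Σ[ j ∈ ℕ ] m ≡ 1 + 2 * j

  odd⇒nonZero : ∀ {m} → Oddℕ m → NonZero m
  odd⇒nonZero (j , refl) = _

  Oddℕ-* : ∀ {a b} → Oddℕ a → Oddℕ b → Oddℕ (a * b)
  Oddℕ-* (i , refl) (j , refl) = i + j + 2 * i * j , expand i j
    where
    expand : ∀ i j → (1 + 2 * i) * (1 + 2 * j) ≡ 1 + 2 * (i + j + 2 * i * j)
    expand = solve-∀

  odd⇒2∤ : ∀ {m} → Oddℕ m → ¬ 2 ∣ m
  odd⇒2∤ (j , refl) 2∣m with ∣1⇒≡1 (∣m+n∣m⇒∣n (subst (2 ∣_) (+-comm 1 (2 * j)) 2∣m) (m∣m*n j))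
  ... | ()

  2^e∣o*x⇒2^e∣x : ∀ e {o x} → Oddℕ o → 2 ^ e ∣ o * x → 2 ^ e ∣ x
  2^e∣o*x⇒2^e∣x zero    {x = x} _ _ = 1∣ x
  2^e∣o*x⇒2^e∣x (suc e) {o} {x} o-odd 2^[1+e]∣ox with evenOrOdd x
  ... | odd h  = ⊥-elim (odd⇒2∤ (Oddℕ-* o-odd (h , refl)) (∣-trans (m∣m*n (2 ^ e)) 2^[1+e]∣ox))
  ... | even h = *-monoʳ-∣ 2 (2^e∣o*x⇒2^e∣x e o-odd 2^e∣oh)
    where
    swap : ∀ o h → o * (2 * h) ≡ 2 * (o * h)
    swap = solve-∀
    2^e∣oh : 2 ^ e ∣ o * h
    2^e∣oh = *-cancelˡ-∣ 2 (subst (2 * 2 ^ e ∣_) (swap o h) 2^[1+e]∣ox)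

  odd-part-valuation : ∀ e {o q x} → Oddℕ o → Oddℕ q → o * x ≡ 2 ^ e * q →
                       2 ^ e ∣ x × ¬ 2 ^ suc e ∣ x
  odd-part-valuation e {o} {q} o-odd q-odd eq =
    2^e∣o*x⇒2^e∣x e o-odd (divides q (trans eq (*-comm (2 ^ e) q))) ,
    λ 2^[1+e]∣x → odd⇒2∤ q-odd (*-cancelˡ-∣ (2 ^ e) {{m^n≢0 2 e}}
      (subst₂ _∣_ (*-comm 2 (2 ^ e)) eq (∣n⇒∣m*n o 2^[1+e]∣x)))

  odd-part : ∀ k {d} → 2 ^ k ∣ d → ¬ 2 ^ suc k ∣ d → Σ[ m ∈ ℕ ] Oddℕ m × d ≡ 2 ^ k * m
  odd-part k (divides q eq) 2^[1+k]∤d with evenOrOdd q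
  ... | even h = ⊥-elim (2^[1+k]∤d (divides h (trans eq (regroup h (2 ^ k)))))
    where
    regroup : ∀ h p → 2 * h * p ≡ h * (2 * p)
    regroup = solve-∀
  ... | odd h  = 1 + 2 * h , (h , refl) , trans eq (*-comm (1 + 2 * h) (2 ^ k))

  double-2^* : ∀ k m → 2 ^ suc k * m ≡ 2 ^ k * m + 2 ^ k * m
  double-2^* k m = trans (*-assoc 2 (2 ^ k) m) (cong (2 ^ k * m +_) (+-identityʳ (2 ^ k * m)))

  s₂-fuel-zero : ∀ f → s₂-fuel f 0 ≡ 0
  s₂-fuel-zero zero    = refl
  s₂-fuel-zero (suc f) = s₂-fuel-zero f

  s₂-fuel-irrelevant : ∀ f g m → m ≤ f → m ≤ g → s₂-fuel f m ≡ s₂-fuel g m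
  s₂-fuel-irrelevant f g zero _ _ = trans (s₂-fuel-zero f) (sym (s₂-fuel-zero g))
  s₂-fuel-irrelevant (suc f) (suc g) (suc m) (s≤s m≤f) (s≤s m≤g) =
    cong (suc m % 2 +_) (s₂-fuel-irrelevant f g (suc m / 2) (half≤ m≤f) (half≤ m≤g))
    where
    half≤ : ∀ {n} → m ≤ n → suc m / 2 ≤ n
    half≤ m≤n = ≤-trans (m<1+n⇒m≤n (m/n<m (suc m) 2 (s≤s (s≤s z≤n)))) m≤n

  s₂-unfold : ∀ n → s₂ n ≡ n % 2 + s₂ (n / 2)
  s₂-unfold zero    = refl
  s₂-unfold (suc n) = cong (suc n % 2 +_)
    (s₂-fuel-irrelevant n (suc n / 2) (suc n / 2) (m<1+n⇒m≤n (m/n<m (suc n) 2 (s≤s (s≤s z≤n)))) ≤-refl)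

  s₂-digit : ∀ r h → r < 2 → s₂ (r + h * 2) ≡ r + s₂ h
  s₂-digit r h r<2 = trans (s₂-unfold (r + h * 2)) (cong₂ _+_ last-digit (cong s₂ rest))
    where
    last-digit : (r + h * 2) % 2 ≡ r
    last-digit = trans ([m+kn]%n≡m%n r h 2) (m<n⇒m%n≡m r<2)
    digits<2 : r % 2 + (h * 2) % 2 < 2
    digits<2 = subst₂ (λ a b → a + b < 2) (sym (m<n⇒m%n≡m r<2)) (sym (m*n%n≡0 h 2))
                 (subst (_< 2) (sym (+-identityʳ r)) r<2)
    rest : (r + h * 2) / 2 ≡ h
    rest = trans (+-distrib-/ r (h * 2) digits<2) (cong₂ _+_ (m<n⇒m/n≡0 r<2) (m*n/n≡m h 2))

  s₂-double : ∀ h → s₂ (2 * h) ≡ s₂ h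
  s₂-double h = trans (cong s₂ (*-comm 2 h)) (s₂-digit 0 h (s≤s z≤n))

  s₂-double+1 : ∀ h → s₂ (1 + 2 * h) ≡ suc (s₂ h)
  s₂-double+1 h = trans (cong (λ t → s₂ (1 + t)) (*-comm 2 h)) (s₂-digit 1 h (s≤s (s≤s z≤n)))

  s₂-pred-double : ∀ n {k} → 1 ≤ n → suc (s₂ (n ∸ 1)) ≡ s₂ n + k →
                   suc (s₂ (2 * n ∸ 1)) ≡ s₂ (2 * n) + suc k
  s₂-pred-double (suc e) {k} _ ih = begin
    suc (s₂ (2 * suc e ∸ 1)) ≡⟨ cong (λ t → suc (s₂ (t ∸ 1))) (*-suc 2 e) ⟩
    suc (s₂ (1 + 2 * e))     ≡⟨ cong suc (s₂-double+1 e) ⟩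
    suc (suc (s₂ e))         ≡⟨ cong suc ih ⟩
    suc (s₂ (suc e) + k)     ≡⟨ +-suc (s₂ (suc e)) k ⟨
    s₂ (suc e) + suc k       ≡⟨ cong (_+ suc k) (s₂-double (suc e)) ⟨
    s₂ (2 * suc e) + suc k   ∎

  s₂-pred : ∀ k {m} → Oddℕ m → suc (s₂ (2 ^ k * m ∸ 1)) ≡ s₂ (2 ^ k * m) + k
  s₂-pred zero {m} (j , m≡1+2j) rewrite *-identityˡ m | m≡1+2j =
    trans (cong suc (s₂-double j)) (trans (sym (s₂-double+1 j)) (sym (+-identityʳ _)))
  s₂-pred (suc k) {m} m-odd@(j , refl) rewrite *-assoc 2 (2 ^ k) m =
    s₂-pred-double (2 ^ k * m) (*-mono-≤ (m^n>0 2 k) (s≤s z≤n)) (s₂-pred k m-odd)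

module Factorials where

  open import Data.Nat using (ℕ; zero; suc; _+_; _*_; _∸_; _^_; _≤_; _<_; _!; z≤n; s≤s)
  open import Data.Nat.Properties
  open import Data.Nat.Combinatorics
    using (_C_; nCk≡n!/k![n-k]!; k![n∸k]!∣n!; nCk≡nC[n∸k]; nCk+nC[k+1]≡[n+1]C[k+1])
  open import Data.Nat.DivMod using (m/n*n≡m)
  open import Data.Nat.Induction using (<-rec)
  open import Data.Nat.Tactic.RingSolver using (solve-∀)
  open ≡-Reasoning
  open Binary

  2^-double : ∀ n → 2 ^ (2 * n) ≡ 2 ^ n * 2 ^ n
  2^-double n = trans (cong (2 ^_) (cong (n +_) (+-identityʳ n))) (^-distribˡ-+-* 2 n n)

  oddProd : ℕ → ℕ → ℕ
  oddProd a zero    = 1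
  oddProd a (suc n) = oddProd a n * (1 + 2 * (a + n))

  oddProd-odd : ∀ a n → Oddℕ (oddProd a n)
  oddProd-odd a zero    = 0 , refl
  oddProd-odd a (suc n) = Oddℕ-* (oddProd-odd a n) (a + n , refl)

  oddProd-+ : ∀ a m n → oddProd a (m + n) ≡ oddProd a m * oddProd (a + m) n
  oddProd-+ a m zero    rewrite +-identityʳ m = sym (*-identityʳ _)
  oddProd-+ a m (suc n) rewrite +-suc m n | oddProd-+ a m n | +-assoc a m n =
    *-assoc (oddProd a m) _ _

  double-factorial : ∀ n → (2 * n) ! ≡ 2 ^ n * n ! * oddProd 0 n
  double-factorial zero    = refl
  double-factorial (suc n) = begin
    (2 * suc n) !
      ≡⟨ cong _! (*-suc 2 n) ⟩
    (2 + 2 * n) * ((1 + 2 * n) * (2 * n) !)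
      ≡⟨ cong (λ t → (2 + 2 * n) * ((1 + 2 * n) * t)) (double-factorial n) ⟩
    (2 + 2 * n) * ((1 + 2 * n) * (2 ^ n * n ! * oddProd 0 n))
      ≡⟨ regroup n (2 ^ n) (n !) (oddProd 0 n) ⟩
    2 * 2 ^ n * (suc n * n !) * (oddProd 0 n * (1 + 2 * n))
      ∎
    where
    regroup : ∀ n p f o → (2 + 2 * n) * ((1 + 2 * n) * (p * f * o))
                          ≡ 2 * p * ((1 + n) * f) * (o * (1 + 2 * n))
    regroup = solve-∀

  -- v₂(n!) = n − s₂(n), stated without subtraction
  Legendre : ℕ → Set
  Legendre n = Σ[ Ω ∈ ℕ ] Oddℕ Ω × n ! * 2 ^ s₂ n ≡ 2 ^ n * Ω

  legendre-double : ∀ h → Legendre h → Legendre (2 * h)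
  legendre-double h (Ω , Ω-odd , eq) = O * Ω , Oddℕ-* (oddProd-odd 0 h) Ω-odd , (begin
    (2 * h) ! * 2 ^ s₂ (2 * h)  ≡⟨ cong₂ _*_ (double-factorial h) (cong (2 ^_) (s₂-double h)) ⟩
    2 ^ h * h ! * O * 2 ^ s₂ h  ≡⟨ regroup (2 ^ h) (h !) O (2 ^ s₂ h) ⟩
    2 ^ h * O * (h ! * 2 ^ s₂ h) ≡⟨ cong (2 ^ h * O *_) eq ⟩
    2 ^ h * O * (2 ^ h * Ω)     ≡⟨ regroup′ (2 ^ h) O Ω ⟩
    2 ^ h * 2 ^ h * (O * Ω)     ≡⟨ cong (_* (O * Ω)) (2^-double h) ⟨
    2 ^ (2 * h) * (O * Ω)       ∎)
    where
    O = oddProd 0 h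
    regroup : ∀ p f o s → p * f * o * s ≡ p * o * (f * s)
    regroup = solve-∀
    regroup′ : ∀ p o w → p * o * (p * w) ≡ p * p * (o * w)
    regroup′ = solve-∀

  legendre-double+1 : ∀ h → Legendre h → Legendre (1 + 2 * h)
  legendre-double+1 h (Ω , Ω-odd , eq) = O′ * Ω , Oddℕ-* (oddProd-odd 0 (suc h)) Ω-odd , (begin
    (1 + 2 * h) ! * 2 ^ s₂ (1 + 2 * h)
      ≡⟨ cong₂ _*_ (cong ((1 + 2 * h) *_) (double-factorial h)) (cong (2 ^_) (s₂-double+1 h)) ⟩
    (1 + 2 * h) * (2 ^ h * h ! * oddProd 0 h) * (2 * 2 ^ s₂ h)
      ≡⟨ regroup (1 + 2 * h) (2 ^ h) (h !) (oddProd 0 h) (2 ^ s₂ h) ⟩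
    2 * 2 ^ h * O′ * (h ! * 2 ^ s₂ h)
      ≡⟨ cong (2 * 2 ^ h * O′ *_) eq ⟩
    2 * 2 ^ h * O′ * (2 ^ h * Ω)
      ≡⟨ regroup′ (2 ^ h) O′ Ω ⟩
    2 * (2 ^ h * 2 ^ h) * (O′ * Ω)
      ≡⟨ cong (λ t → 2 * t * (O′ * Ω)) (2^-double h) ⟨
    2 ^ (1 + 2 * h) * (O′ * Ω)
      ∎)
    where
    O′ = oddProd 0 (suc h)
    regroup : ∀ a p f o s → a * (p * f * o) * (2 * s) ≡ 2 * p * (o * a) * (f * s)
    regroup = solve-∀
    regroup′ : ∀ p o w → 2 * p * o * (p * w) ≡ 2 * (p * p) * (o * w)
    regroup′ = solve-∀

  legendre : ∀ n → Legendre n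
  legendre = <-rec Legendre step
    where
    step : ∀ n → (∀ {h} → h < n → Legendre h) → Legendre n
    step n rec with evenOrOdd n
    ... | even zero    = 1 , (0 , refl) , refl
    ... | even (suc h) = legendre-double (suc h) (rec (m<m+n (suc h) (s≤s z≤n)))
    ... | odd h        = legendre-double+1 h (rec (s≤s (m≤n*m h 2)))

  binomial-factorials : ∀ {n k} → k ≤ n → (n C k) * (k ! * (n ∸ k) !) ≡ n !
  binomial-factorials {n} {k} k≤n = trans (cong (_* (k ! * (n ∸ k) !)) (nCk≡n!/k![n-k]! k≤n))
                                          (m/n*n≡m {{k !* (n ∸ k) !≢0}} (k![n∸k]!∣n! k≤n))

  central-binomial : ∀ n → ((2 * n) C n) * n ! ≡ 2 ^ n * oddProd 0 n
  central-binomial n = *-cancelʳ-≡ _ _ (n !) {{n !≢0}} (begin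
    ((2 * n) C n) * n ! * n !             ≡⟨ *-assoc ((2 * n) C n) (n !) (n !) ⟩
    ((2 * n) C n) * (n ! * n !)           ≡⟨ cong (λ t → ((2 * n) C n) * (n ! * t !)) 2n∸n≡n ⟨
    ((2 * n) C n) * (n ! * (2 * n ∸ n) !) ≡⟨ binomial-factorials (m≤n*m n 2) ⟩
    (2 * n) !                             ≡⟨ double-factorial n ⟩
    2 ^ n * n ! * oddProd 0 n             ≡⟨ swap (2 ^ n) (n !) (oddProd 0 n) ⟩
    2 ^ n * oddProd 0 n * n !             ∎)
    where
    2n∸n≡n : 2 * n ∸ n ≡ n
    2n∸n≡n = trans (m+n∸m≡n n (n + 0)) (+-identityʳ n)
    swap : ∀ p f o → p * f * o ≡ p * o * f
    swap = solve-∀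

  central-binomial-halved : ∀ e → 2 * ((2 * suc e ∸ 1) C e) ≡ (2 * suc e) C suc e
  central-binomial-halved e = begin
    2 * (N C e)          ≡⟨ cong (N C e +_) (+-identityʳ (N C e)) ⟩
    N C e + N C e        ≡⟨ cong (N C e +_) symmetric ⟩
    N C e + N C suc e    ≡⟨ nCk+nC[k+1]≡[n+1]C[k+1] N e ⟩
    suc N C suc e        ∎
    where
    N = 2 * suc e ∸ 1
    symmetric : N C e ≡ N C suc e
    symmetric = trans (nCk≡nC[n∸k] (m≤m+n e (suc e + 0)))
                      (cong (N C_) (trans (m+n∸m≡n e (suc e + 0)) (+-identityʳ (suc e))))

  lower-binomial : ∀ d → 1 ≤ d → 2 * ((2 * d ∸ 1) C (d ∸ 1)) * d ! ≡ 2 ^ d * oddProd 0 d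
  lower-binomial (suc e) _ =
    trans (cong (_* suc e !) (central-binomial-halved e)) (central-binomial (suc e))

  upper-binomial : ∀ d → 1 ≤ d → 2 * ((4 * d ∸ 1) C (2 * d ∸ 1)) * d ! ≡ 2 ^ d * oddProd d d
  upper-binomial d 1≤d = *-cancelʳ-≡ _ _ (2 ^ d * O) {{2^d*O≢0}} (begin
    2 * A * d ! * (2 ^ d * O)                      ≡⟨ regroup (2 * A) (d !) (2 ^ d) O ⟩
    2 * A * (2 ^ d * d ! * O)                      ≡⟨ cong (2 * A *_) (double-factorial d) ⟨
    2 * A * (2 * d) !                              ≡⟨ cong (λ t → 2 * ((t ∸ 1) C (2 * d ∸ 1)) * (2 * d) !)
                                                           (*-assoc 2 2 d) ⟩
    2 * ((2 * (2 * d) ∸ 1) C (2 * d ∸ 1)) * (2 * d) ! ≡⟨ lower-binomial (2 * d) (≤-trans 1≤d (m≤n*m d 2)) ⟩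
    2 ^ (2 * d) * oddProd 0 (2 * d)                ≡⟨ cong₂ _*_ (2^-double d) O[2d]≡O*U ⟩
    2 ^ d * 2 ^ d * (O * U)                        ≡⟨ regroup′ (2 ^ d) O U ⟩
    2 ^ d * U * (2 ^ d * O)                        ∎)
    where
    A = (4 * d ∸ 1) C (2 * d ∸ 1)
    O = oddProd 0 d
    U = oddProd d d
    2^d*O≢0 = m*n≢0 (2 ^ d) O {{m^n≢0 2 d}} {{odd⇒nonZero (oddProd-odd 0 d)}}
    O[2d]≡O*U : oddProd 0 (2 * d) ≡ O * U
    O[2d]≡O*U = trans (cong (oddProd 0) (cong (d +_) (+-identityʳ d))) (oddProd-+ 0 d d)
    regroup : ∀ a f p o → a * f * (p * o) ≡ a * (p * f * o)
    regroup = solve-∀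
    regroup′ : ∀ p o u → p * p * (o * u) ≡ p * u * (p * o)
    regroup′ = solve-∀

  cancel-factorial : ∀ d x {Ω y} → d ! * 2 ^ s₂ d ≡ 2 ^ d * Ω → x * d ! ≡ 2 ^ d * y →
                     x * Ω ≡ 2 ^ s₂ d * y
  cancel-factorial d x {Ω} {y} legendre-eq eq = *-cancelˡ-≡ _ _ (2 ^ d) {{m^n≢0 2 d}} (begin
    2 ^ d * (x * Ω)        ≡⟨ swap (2 ^ d) x Ω ⟩
    x * (2 ^ d * Ω)        ≡⟨ cong (x *_) legendre-eq ⟨
    x * (d ! * 2 ^ s₂ d)   ≡⟨ *-assoc x (d !) (2 ^ s₂ d) ⟨
    x * d ! * 2 ^ s₂ d     ≡⟨ cong (_* 2 ^ s₂ d) eq ⟩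
    2 ^ d * y * 2 ^ s₂ d   ≡⟨ swap′ (2 ^ d) y (2 ^ s₂ d) ⟩
    2 ^ d * (2 ^ s₂ d * y) ∎)
    where
    swap : ∀ p x w → p * (x * w) ≡ x * (p * w)
    swap = solve-∀
    swap′ : ∀ p y t → p * y * t ≡ p * (t * y)
    swap′ = solve-∀

  binomials-oddProd : ∀ d → 1 ≤ d → Σ[ Ω ∈ ℕ ] Oddℕ Ω
                      × 2 * ((4 * d ∸ 1) C (2 * d ∸ 1)) * Ω ≡ 2 ^ s₂ d * oddProd d d
                      × 2 * ((2 * d ∸ 1) C (d ∸ 1)) * Ω ≡ 2 ^ s₂ d * oddProd 0 d
  binomials-oddProd d 1≤d with legendre d
  ... | Ω , Ω-odd , legendre-eq =
    Ω , Ω-odd , cancel-factorial d (2 * ((4 * d ∸ 1) C (2 * d ∸ 1))) legendre-eq (upper-binomial d 1≤d)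
              , cancel-factorial d (2 * ((2 * d ∸ 1) C (d ∸ 1))) legendre-eq (lower-binomial d 1≤d)

module OddProducts where

  open import Data.Nat as ℕ using (ℕ; zero; suc)
  import Data.Nat.Properties as ℕP
  import Data.Nat.Tactic.RingSolver as ℕ-Solver
  open import Data.Integer using (ℤ; +_; -[1+_]; _+_; _-_; _*_; -_; _^_; ∣_∣)
  open import Data.Integer.Properties
    using (pos-*; abs-*; ∣-i∣≡∣i∣; neg-involutive; +-identityˡ; *-comm; *-identityʳ; *-assoc;
           *-cancelˡ-≡; ^-distribˡ-+-*)
  open import Data.Integer.Tactic.RingSolver using (solve-∀)
  open ≡-Reasoning
  open Binary using (Oddℕ; odd-part-valuation; double-2^*)
  open Factorials using (oddProd)

  pos-^ : ∀ m n → + (m ℕ.^ n) ≡ (+ m) ^ n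
  pos-^ m zero    = refl
  pos-^ m (suc n) = trans (pos-* m (m ℕ.^ n)) (cong (+ m *_) (pos-^ m n))

  pos-1+2* : ∀ n → + (1 ℕ.+ 2 ℕ.* n) ≡ + 1 + + 2 * + n
  pos-1+2* n = cong (_+_ (+ 1)) (pos-* 2 n)

  infix 4 _≡_mod_
  record _≡_mod_ (x y M : ℤ) : Set where
    constructor _,_
    field
      quotient : ℤ
      equation : x ≡ y + quotient * M

  mod-refl : ∀ {M} x → x ≡ x mod M
  mod-refl {M} x = + 0 , lemma x M
    where
    lemma : ∀ x M → x ≡ x + + 0 * M
    lemma = solve-∀

  mod-reflexive : ∀ {M x y} → x ≡ y → x ≡ y mod M
  mod-reflexive {x = x} refl = mod-refl x

  mod-trans : ∀ {M x y z} → x ≡ y mod M → y ≡ z mod M → x ≡ z mod M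
  mod-trans {M} {z = z} (a , refl) (b , refl) = b + a , lemma z a b M
    where
    lemma : ∀ z a b M → z + b * M + a * M ≡ z + (b + a) * M
    lemma = solve-∀

  mod-+ : ∀ {M x y x′ y′} → x ≡ x′ mod M → y ≡ y′ mod M → x + y ≡ x′ + y′ mod M
  mod-+ {M} {x′ = x′} {y′} (a , refl) (b , refl) = a + b , lemma x′ y′ a b M
    where
    lemma : ∀ x y a b M → x + a * M + (y + b * M) ≡ x + y + (a + b) * M
    lemma = solve-∀

  mod-* : ∀ {M x y x′ y′} → x ≡ x′ mod M → y ≡ y′ mod M → x * y ≡ x′ * y′ mod M
  mod-* {M} {x′ = x′} {y′} (a , refl) (b , refl) = a * y′ + x′ * b + a * b * M , lemma x′ y′ a b M
    where
    lemma : ∀ x y a b M → (x + a * M) * (y + b * M) ≡ x * y + (a * y + x * b + a * b * M) * M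
    lemma = solve-∀

  Odd : ℤ → Set
  Odd x = x ≡ + 1 mod + 2

  double-even : ∀ x → x * + 2 ≡ + 0 mod + 2
  double-even x = x , sym (+-identityˡ (x * + 2))

  Oddℕ⇒Odd : ∀ {m} → Oddℕ m → Odd (+ m)
  Oddℕ⇒Odd (j , refl) = + j , trans (pos-1+2* j) (lemma (+ j))
    where
    lemma : ∀ j → + 1 + + 2 * j ≡ + 1 + j * + 2
    lemma = solve-∀

  Odd⇒Oddℕ∣∣ : ∀ {x} → Odd x → Oddℕ ∣ x ∣
  Odd⇒Oddℕ∣∣ (+ n , refl) = n , cong ∣_∣ (trans (lemma (+ n)) (sym (pos-1+2* n)))
    where
    lemma : ∀ n → + 1 + n * + 2 ≡ + 1 + + 2 * n
    lemma = solve-∀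
  Odd⇒Oddℕ∣∣ (-[1+ n ] , refl) = n , (begin
    ∣ + 1 + -[1+ n ] * + 2 ∣ ≡⟨ cong ∣_∣ (lemma (+ n)) ⟩
    ∣ - (+ 1 + + 2 * + n) ∣  ≡⟨ ∣-i∣≡∣i∣ (+ 1 + + 2 * + n) ⟩
    ∣ + 1 + + 2 * + n ∣      ≡⟨ cong ∣_∣ (pos-1+2* n) ⟨
    1 ℕ.+ 2 ℕ.* n            ∎)
    where
    lemma : ∀ n → + 1 + (- (+ 1 + n)) * + 2 ≡ - (+ 1 + + 2 * n)
    lemma = solve-∀

  infix 4 _=2^_·odd
  _=2^_·odd : ℤ → ℕ → Set
  x =2^ k ·odd = Σ[ q ∈ ℤ ] Odd q × x ≡ (+ 2) ^ k * q

  HasV₂-intro : ∀ {o x e} → Oddℕ o → + o * x =2^ e ·odd → x HasV₂ e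
  HasV₂-intro {o} {x} {e} o-odd (q , q-odd , eq) =
    odd-part-valuation e o-odd (Odd⇒Oddℕ∣∣ q-odd) (begin
      o ℕ.* ∣ x ∣             ≡⟨ abs-* (+ o) x ⟨
      ∣ + o * x ∣             ≡⟨ cong ∣_∣ eq ⟩
      ∣ (+ 2) ^ e * q ∣       ≡⟨ abs-* ((+ 2) ^ e) q ⟩
      ∣ (+ 2) ^ e ∣ ℕ.* ∣ q ∣ ≡⟨ cong (λ t → ∣ t ∣ ℕ.* ∣ q ∣) (pos-^ 2 e) ⟨
      2 ℕ.^ e ℕ.* ∣ q ∣       ∎)

  prod : (ℕ → ℤ) → ℕ → ℤ
  prod f zero    = + 1
  prod f (suc n) = prod f n * f n

  -- prod′ f n = Σ_{j<n} Π_{i<n, i≠j} f i, the coefficient of δ in prod (λ i → f i + δ) n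
  prod′ : (ℕ → ℤ) → ℕ → ℤ
  prod′ f zero    = + 0
  prod′ f (suc n) = prod′ f n * f n + prod f n

  prod-+ : ∀ f m n → prod f (m ℕ.+ n) ≡ prod f m * prod (λ i → f (m ℕ.+ i)) n
  prod-+ f m zero    rewrite ℕP.+-identityʳ m = sym (*-identityʳ (prod f m))
  prod-+ f m (suc n) rewrite ℕP.+-suc m n | prod-+ f m n = *-assoc (prod f m) _ _

  prod′-+ : ∀ f m n → prod′ f (m ℕ.+ n) ≡
            prod′ f m * prod (λ i → f (m ℕ.+ i)) n + prod f m * prod′ (λ i → f (m ℕ.+ i)) n
  prod′-+ f m zero    rewrite ℕP.+-identityʳ m = lemma (prod′ f m) (prod f m)
    where
    lemma : ∀ e p → e ≡ e * + 1 + p * + 0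
    lemma = solve-∀
  prod′-+ f m (suc n) rewrite ℕP.+-suc m n | prod′-+ f m n | prod-+ f m n =
    lemma (prod′ f m) (prod g n) (prod f m) (prod′ g n) (g n)
    where
    g = λ i → f (m ℕ.+ i)
    lemma : ∀ e p e′ p′ z → (e * p + e′ * p′) * z + e′ * p ≡ e * (p * z) + e′ * (p′ * z + p)
    lemma = solve-∀

  prod-mod : ∀ {M f g} → (∀ i → f i ≡ g i mod M) → ∀ n → prod f n ≡ prod g n mod M
  prod-mod f≡g zero    = mod-reflexive refl
  prod-mod f≡g (suc n) = mod-* (prod-mod f≡g n) (f≡g n)

  prod′-mod : ∀ {M f g} → (∀ i → f i ≡ g i mod M) → ∀ n → prod′ f n ≡ prod′ g n mod M
  prod′-mod f≡g zero    = mod-reflexive refl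
  prod′-mod f≡g (suc n) = mod-+ (mod-* (prod′-mod f≡g n) (f≡g n)) (prod-mod f≡g n)

  prod-odd : ∀ {f} → (∀ i → Odd (f i)) → ∀ n → Odd (prod f n)
  prod-odd odd zero    = mod-reflexive refl
  prod-odd odd (suc n) = mod-* (prod-odd odd n) (odd n)

  prod′-odd : ∀ {f} → (∀ i → Odd (f i)) → ∀ n → prod′ f n ≡ + n mod + 2
  prod′-odd odd zero    = mod-reflexive refl
  prod′-odd odd (suc n) = mod-trans (mod-+ (mod-* (prod′-odd odd n) (odd n)) (prod-odd odd n))
                                    (mod-reflexive (lemma (+ n)))
    where
    lemma : ∀ n → n * + 1 + + 1 ≡ + 1 + n
    lemma = solve-∀

  prod-+δ : ∀ {f g δ} → (∀ i → g i ≡ f i + δ) → ∀ n →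
            Σ[ S ∈ ℤ ] prod g n ≡ prod f n + δ * prod′ f n + δ * δ * S
  prod-+δ {δ = δ} g≡f+δ zero = + 0 , lemma δ
    where
    lemma : ∀ δ → + 1 ≡ + 1 + δ * + 0 + δ * δ * + 0
    lemma = solve-∀
  prod-+δ {f} {g} {δ} g≡f+δ (suc n) with prod-+δ g≡f+δ n
  ... | S , eq = prod′ f n + S * (f n + δ) , (begin
    prod g n * g n
      ≡⟨ cong₂ _*_ eq (g≡f+δ n) ⟩
    (prod f n + δ * prod′ f n + δ * δ * S) * (f n + δ)
      ≡⟨ lemma (prod f n) (prod′ f n) S (f n) δ ⟩
    prod f n * f n + δ * (prod′ f n * f n + prod f n) + δ * δ * (prod′ f n + S * (f n + δ))
      ∎)
    where
    lemma : ∀ p e S y δ → (p + δ * e + δ * δ * S) * (y + δ)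
                          ≡ p * y + δ * (e * y + p) + δ * δ * (e + S * (y + δ))
    lemma = solve-∀

  prod′-dyadic : ∀ {f m} → (∀ i → Odd (f i)) → Oddℕ m →
                 (∀ k i → f (2 ℕ.^ k ℕ.* m ℕ.+ i) ≡ f i mod (+ 2) ^ (2 ℕ.+ k)) →
                 ∀ k → prod′ f (2 ℕ.^ k ℕ.* m) ≡ (+ 2) ^ k mod (+ 2) ^ (1 ℕ.+ k)
  prod′-dyadic {f} {m} odd m-odd shift zero = mod-trans (prod′-odd odd (1 ℕ.* m))
    (subst (λ t → Odd (+ t)) (sym (ℕP.*-identityˡ m)) (Oddℕ⇒Odd m-odd))
  prod′-dyadic {f} {m} odd m-odd shift (suc k) =
    subst (λ t → prod′ f t ≡ (+ 2) ^ suc k mod (+ 2) ^ (2 ℕ.+ k)) (sym (double-2^* k m))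
          (mod-trans halves doubled)
    where
    n = 2 ℕ.^ k ℕ.* m
    E = prod′ f n
    P = prod f n
    halves : prod′ f (n ℕ.+ n) ≡ E * P + P * E mod (+ 2) ^ (2 ℕ.+ k)
    halves = mod-trans (mod-reflexive (prod′-+ f n n))
                       (mod-+ (mod-* (mod-refl E) (prod-mod (shift k) n))
                              (mod-* (mod-refl P) (prod′-mod (shift k) n)))
    doubled : E * P + P * E ≡ (+ 2) ^ suc k mod (+ 2) ^ (2 ℕ.+ k)
    doubled with prod′-dyadic odd m-odd shift k | prod-odd odd n
    ... | a , E≡ | p , P≡ rewrite E≡ | P≡ = a + p + + 2 * a * p , lemma ((+ 2) ^ k) a p
      where
      lemma : ∀ T a p → (T + a * (+ 2 * T)) * (+ 1 + p * + 2) + (+ 1 + p * + 2) * (T + a * (+ 2 * T))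
                        ≡ + 2 * T + (a + p + + 2 * a * p) * (+ 2 * (+ 2 * T))
      lemma = solve-∀

  ap : ℤ → ℕ → ℤ
  ap x n = prod (λ i → x + + 2 * + i) n

  ap-sucˡ : ∀ x n → ap x (suc n) ≡ x * ap (x + + 2) n
  ap-sucˡ x zero    = lemma x
    where
    lemma : ∀ x → + 1 * (x + + 2 * + 0) ≡ x * + 1
    lemma = solve-∀
  ap-sucˡ x (suc n) = begin
    ap x (suc n) * (x + + 2 * (+ 1 + + n))       ≡⟨ cong (_* (x + + 2 * (+ 1 + + n))) (ap-sucˡ x n) ⟩
    x * ap (x + + 2) n * (x + + 2 * (+ 1 + + n)) ≡⟨ lemma x (+ n) (ap (x + + 2) n) ⟩
    x * (ap (x + + 2) n * (x + + 2 + + 2 * + n)) ∎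
    where
    lemma : ∀ x n P → x * P * (x + + 2 * (+ 1 + n)) ≡ x * (P * (x + + 2 + + 2 * n))
    lemma = solve-∀

  oddSquareGap : ℤ → ℕ → ℤ
  oddSquareGap y i = y * y - (+ 1 + + 2 * + i) * (+ 1 + + 2 * + i)

  evenSquareGap : ℤ → ℕ → ℤ
  evenSquareGap y i = y * y - (+ 2 + + 2 * + i) * (+ 2 + + 2 * + i)

  ap-centred-even : ∀ y n → ap (y - + 2 * + n + + 1) (n ℕ.+ n) ≡ prod (oddSquareGap y) n
  ap-centred-even y zero    = refl
  ap-centred-even y (suc n) rewrite ℕP.+-suc n n = begin
    ap x (suc (n ℕ.+ n)) * last                 ≡⟨ cong (_* last) (ap-sucˡ x (n ℕ.+ n)) ⟩
    x * ap (x + + 2) (n ℕ.+ n) * last           ≡⟨ cong (λ z → x * ap z (n ℕ.+ n) * last) (inner y N) ⟩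
    x * ap (y - + 2 * N + + 1) (n ℕ.+ n) * last ≡⟨ cong (λ z → x * z * last) (ap-centred-even y n) ⟩
    x * prod (oddSquareGap y) n * last          ≡⟨ outer y N (prod (oddSquareGap y) n) ⟩
    prod (oddSquareGap y) n * oddSquareGap y n  ∎
    where
    N = + n
    x = y - + 2 * (+ 1 + N) + + 1
    last = x + + 2 * (+ 1 + (N + N))
    inner : ∀ y N → y - + 2 * (+ 1 + N) + + 1 + + 2 ≡ y - + 2 * N + + 1
    inner = solve-∀
    outer : ∀ y N P → (y - + 2 * (+ 1 + N) + + 1) * P * (y - + 2 * (+ 1 + N) + + 1 + + 2 * (+ 1 + (N + N)))
                      ≡ P * (y * y - (+ 1 + + 2 * N) * (+ 1 + + 2 * N))
    outer = solve-∀

  ap-centred-odd : ∀ y n → ap (y - + 2 * + n) (suc (n ℕ.+ n)) ≡ y * prod (evenSquareGap y) n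
  ap-centred-odd y zero    = lemma y
    where
    lemma : ∀ y → + 1 * (y - + 2 * + 0 + + 2 * + 0) ≡ y * + 1
    lemma = solve-∀
  ap-centred-odd y (suc n) rewrite ℕP.+-suc n n = begin
    ap x (suc (suc (n ℕ.+ n))) * last                ≡⟨ cong (_* last) (ap-sucˡ x (suc (n ℕ.+ n))) ⟩
    x * ap (x + + 2) (suc (n ℕ.+ n)) * last          ≡⟨ cong (λ z → x * ap z (suc (n ℕ.+ n)) * last) (inner y N) ⟩
    x * ap (y - + 2 * N) (suc (n ℕ.+ n)) * last      ≡⟨ cong (λ z → x * z * last) (ap-centred-odd y n) ⟩
    x * (y * prod (evenSquareGap y) n) * last        ≡⟨ outer y N (prod (evenSquareGap y) n) ⟩
    y * (prod (evenSquareGap y) n * evenSquareGap y n) ∎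
    where
    N = + n
    x = y - + 2 * (+ 1 + N)
    last = x + + 2 * (+ 2 + (N + N))
    inner : ∀ y N → y - + 2 * (+ 1 + N) + + 2 ≡ y - + 2 * N
    inner = solve-∀
    outer : ∀ y N P → (y - + 2 * (+ 1 + N)) * (y * P) * (y - + 2 * (+ 1 + N) + + 2 * (+ 2 + (N + N)))
                      ≡ y * (P * (y * y - (+ 2 + + 2 * N) * (+ 2 + + 2 * N)))
    outer = solve-∀

  oddSquareGap-odd : ∀ {y} → y ≡ + 0 mod + 2 → ∀ i → Odd (oddSquareGap y i)
  oddSquareGap-odd (h , refl) i = + 2 * h * h - + 2 * + i - + 2 * + i * + i - + 1 , expand h (+ i)
    where
    expand : ∀ h i → (+ 0 + h * + 2) * (+ 0 + h * + 2) - (+ 1 + + 2 * i) * (+ 1 + + 2 * i)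
                     ≡ + 1 + (+ 2 * h * h - + 2 * i - + 2 * i * i - + 1) * + 2
    expand = solve-∀

  evenSquareGap-odd : ∀ {y} → Odd y → ∀ i → Odd (evenSquareGap y i)
  evenSquareGap-odd (h , refl) i =
    + 2 * h * h + + 2 * h - + 2 * (+ 1 + + i) * (+ 1 + + i) , expand h (+ i)
    where
    expand : ∀ h i → (+ 1 + h * + 2) * (+ 1 + h * + 2) - (+ 2 + + 2 * i) * (+ 2 + + 2 * i)
                     ≡ + 1 + (+ 2 * h * h + + 2 * h - + 2 * (+ 1 + i) * (+ 1 + i)) * + 2
    expand = solve-∀

  oddSquareGap-shift : ∀ y {m} k i →
                       oddSquareGap y (2 ℕ.^ k ℕ.* m ℕ.+ i) ≡ oddSquareGap y i mod (+ 2) ^ (2 ℕ.+ k)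
  oddSquareGap-shift y {m} k i = - (+ m * (+ 1 + + 2 * + i + T * + m)) , (begin
    oddSquareGap y (2 ℕ.^ k ℕ.* m ℕ.+ i)
      ≡⟨ cong (λ a → y * y - (+ 1 + + 2 * (a + + i)) * (+ 1 + + 2 * (a + + i))) a≡Tm ⟩
    y * y - (+ 1 + + 2 * (T * + m + + i)) * (+ 1 + + 2 * (T * + m + + i))
      ≡⟨ lemma y T (+ m) (+ i) ⟩
    oddSquareGap y i + - (+ m * (+ 1 + + 2 * + i + T * + m)) * (+ 2 * (+ 2 * T))
      ∎)
    where
    T = (+ 2) ^ k
    a≡Tm : + (2 ℕ.^ k ℕ.* m) ≡ T * + m
    a≡Tm = trans (pos-* (2 ℕ.^ k) m) (cong (_* + m) (pos-^ 2 k))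
    lemma : ∀ y T m i → y * y - (+ 1 + + 2 * (T * m + i)) * (+ 1 + + 2 * (T * m + i))
                        ≡ y * y - (+ 1 + + 2 * i) * (+ 1 + + 2 * i)
                          + - (m * (+ 1 + + 2 * i + T * m)) * (+ 2 * (+ 2 * T))
    lemma = solve-∀

  oddProd-ap : ∀ a n → + oddProd a n ≡ ap (+ 1 + + 2 * + a) n
  oddProd-ap a zero    = refl
  oddProd-ap a (suc n) = begin
    + (oddProd a n ℕ.* (1 ℕ.+ 2 ℕ.* (a ℕ.+ n)))         ≡⟨ pos-* (oddProd a n) _ ⟩
    + oddProd a n * + (1 ℕ.+ 2 ℕ.* (a ℕ.+ n))           ≡⟨ cong₂ _*_ (oddProd-ap a n) (pos-1+2* (a ℕ.+ n)) ⟩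
    ap (+ 1 + + 2 * + a) n * (+ 1 + + 2 * (+ a + + n))  ≡⟨ cong (ap (+ 1 + + 2 * + a) n *_) (lemma (+ a) (+ n)) ⟩
    ap (+ 1 + + 2 * + a) n * (+ 1 + + 2 * + a + + 2 * + n) ∎
    where
    lemma : ∀ a n → + 1 + + 2 * (a + n) ≡ + 1 + + 2 * a + + 2 * n
    lemma = solve-∀

  negOnePow-even : ∀ n → negOnePow (n ℕ.+ n) ≡ + 1
  negOnePow-even zero    = refl
  negOnePow-even (suc n) rewrite ℕP.+-suc n n =
    trans (neg-involutive (negOnePow (n ℕ.+ n))) (negOnePow-even n)

  Δ : ℕ → ℤ
  Δ d = + oddProd d d - negOnePow d * + oddProd 0 d

  Δ-odd-expansion : ∀ n → let D = + 1 + (+ n + + n); R = prod (evenSquareGap D) n; δ = + 8 * (D * D) in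
                    Σ[ S ∈ ℤ ] Δ (suc (n ℕ.+ n))
                                 ≡ + 3 * D * (R + δ * prod′ (evenSquareGap D) n + δ * δ * S) + D * R
  Δ-odd-expansion n = S , (begin
    Δ d                                                 ≡⟨ cong (λ σ → U - σ * O) (cong -_ (negOnePow-even n)) ⟩
    U - - + 1 * O                                       ≡⟨ cong₂ (λ u o → u - - + 1 * o) U≡ O≡ ⟩
    + 3 * D * prod g n - - + 1 * (D * R)                ≡⟨ cong (λ u → + 3 * D * u - - + 1 * (D * R)) S≡ ⟩
    + 3 * D * (R + δ * E + δ * δ * S) - - + 1 * (D * R) ≡⟨ minus-minus (+ 3 * D * (R + δ * E + δ * δ * S)) (D * R) ⟩
    + 3 * D * (R + δ * E + δ * δ * S) + D * R           ∎)
    where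
    d = suc (n ℕ.+ n)
    N = + n
    D = + 1 + (N + N)
    U = + oddProd d d
    O = + oddProd 0 d
    R = prod (evenSquareGap D) n
    E = prod′ (evenSquareGap D) n
    g = evenSquareGap (+ 3 * D)
    δ = + 8 * (D * D)
    O≡ : O ≡ D * R
    O≡ = trans (oddProd-ap 0 d) (trans (cong (λ x → ap x d) (centre N)) (ap-centred-odd D n))
      where
      centre : ∀ N → + 1 ≡ + 1 + (N + N) - + 2 * N
      centre = solve-∀
    U≡ : U ≡ + 3 * D * prod g n
    U≡ = trans (oddProd-ap d d) (trans (cong (λ x → ap x d) (centre N)) (ap-centred-odd (+ 3 * D) n))
      where
      centre : ∀ N → + 1 + + 2 * (+ 1 + (N + N)) ≡ + 3 * (+ 1 + (N + N)) - + 2 * N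
      centre = solve-∀
    expansion : Σ[ S ∈ ℤ ] prod g n ≡ R + δ * E + δ * δ * S
    expansion = prod-+δ (λ i → gap D (+ 2 + + 2 * + i)) n
      where
      gap : ∀ D c → (+ 3 * D) * (+ 3 * D) - c * c ≡ D * D - c * c + + 8 * (D * D)
      gap = solve-∀
    S = proj₁ expansion
    S≡ = proj₂ expansion
    minus-minus : ∀ u o → u - - + 1 * o ≡ u + o
    minus-minus = solve-∀

  Δ-odd : ∀ n → Δ (suc (n ℕ.+ n)) =2^ 2 ·odd
  Δ-odd n = q , q-odd , trans Δ≡ (factor-4 D R E S)
    where
    S = proj₁ (Δ-odd-expansion n)
    Δ≡ = proj₂ (Δ-odd-expansion n)
    N = + n
    D = + 1 + (N + N)
    R = prod (evenSquareGap D) n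
    E = prod′ (evenSquareGap D) n
    e = + 3 * D * D * (E + + 8 * (D * D) * S)
    q = D * (R + e * + 2)
    D-odd : Odd D
    D-odd = N , regroup N
      where
      regroup : ∀ N → + 1 + (N + N) ≡ + 1 + N * + 2
      regroup = solve-∀
    q-odd : Odd q
    q-odd = mod-* D-odd (mod-+ (prod-odd (evenSquareGap-odd D-odd) n) (double-even e))
    factor-4 : ∀ D R E S → + 3 * D * (R + + 8 * (D * D) * E + + 8 * (D * D) * (+ 8 * (D * D)) * S) + D * R
                        ≡ + 4 * (D * (R + + 3 * D * D * (E + + 8 * (D * D) * S) * + 2))
    factor-4 = solve-∀

  Δ-even-expansion : ∀ n → let N = + n; δ = + 32 * (N * N) in
                     Σ[ S ∈ ℤ ] Δ (n ℕ.+ n) ≡ δ * prod′ (oddSquareGap (+ 2 * N)) n + δ * δ * S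
  Δ-even-expansion n = S , (begin
    Δ d                             ≡⟨ cong (λ σ → U - σ * O) (negOnePow-even n) ⟩
    U - + 1 * O                     ≡⟨ cong₂ (λ u o → u - + 1 * o) U≡ O≡ ⟩
    prod g n - + 1 * R              ≡⟨ cong (λ u → u - + 1 * R) S≡ ⟩
    R + δ * E + δ * δ * S - + 1 * R ≡⟨ cancel R (δ * E) (δ * δ * S) ⟩
    δ * E + δ * δ * S               ∎)
    where
    d = n ℕ.+ n
    N = + n
    U = + oddProd d d
    O = + oddProd 0 d
    f = oddSquareGap (+ 2 * N)
    g = oddSquareGap (+ 6 * N)
    R = prod f n
    E = prod′ f n
    δ = + 32 * (N * N)
    O≡ : O ≡ R
    O≡ = trans (oddProd-ap 0 d) (trans (cong (λ x → ap x d) (centre N)) (ap-centred-even (+ 2 * N) n))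
      where
      centre : ∀ N → + 1 ≡ + 2 * N - + 2 * N + + 1
      centre = solve-∀
    U≡ : U ≡ prod g n
    U≡ = trans (oddProd-ap d d) (trans (cong (λ x → ap x d) (centre N)) (ap-centred-even (+ 6 * N) n))
      where
      centre : ∀ N → + 1 + + 2 * (N + N) ≡ + 6 * N - + 2 * N + + 1
      centre = solve-∀
    expansion : Σ[ S ∈ ℤ ] prod g n ≡ R + δ * E + δ * δ * S
    expansion = prod-+δ (λ i → gap N (+ 1 + + 2 * + i)) n
      where
      gap : ∀ N c → (+ 6 * N) * (+ 6 * N) - c * c ≡ (+ 2 * N) * (+ 2 * N) - c * c + + 32 * (N * N)
      gap = solve-∀
    S = proj₁ expansion
    S≡ = proj₂ expansion
    cancel : ∀ r x y → r + x + y - + 1 * r ≡ x + y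
    cancel = solve-∀

  2^[2+3[1+v]] : ∀ v → (+ 2) ^ (2 ℕ.+ 3 ℕ.* suc v) ≡ + 32 * ((+ 2) ^ v * (+ 2) ^ v * (+ 2) ^ v)
  2^[2+3[1+v]] v = begin
    (+ 2) ^ (2 ℕ.+ 3 ℕ.* suc v)       ≡⟨ cong ((+ 2) ^_) (exponent v) ⟩
    (+ 2) ^ (5 ℕ.+ (v ℕ.+ (v ℕ.+ v))) ≡⟨ ^-distribˡ-+-* (+ 2) 5 (v ℕ.+ (v ℕ.+ v)) ⟩
    + 32 * (+ 2) ^ (v ℕ.+ (v ℕ.+ v))  ≡⟨ cong (+ 32 *_) (^-distribˡ-+-* (+ 2) v (v ℕ.+ v)) ⟩
    + 32 * (T * (+ 2) ^ (v ℕ.+ v))    ≡⟨ cong (λ t → + 32 * (T * t)) (^-distribˡ-+-* (+ 2) v v) ⟩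
    + 32 * (T * (T * T))              ≡⟨ cong (+ 32 *_) (*-assoc T T T) ⟨
    + 32 * (T * T * T)                ∎
    where
    T = (+ 2) ^ v
    exponent : ∀ v → 2 ℕ.+ 3 ℕ.* suc v ≡ 5 ℕ.+ (v ℕ.+ (v ℕ.+ v))
    exponent = ℕ-Solver.solve-∀

  Δ-even : ∀ v {m} → Oddℕ m → Δ (2 ℕ.^ v ℕ.* m ℕ.+ 2 ℕ.^ v ℕ.* m) =2^ 2 ℕ.+ 3 ℕ.* suc v ·odd
  Δ-even v {m} m-odd = q , q-odd , (begin
    Δ (n ℕ.+ n)                         ≡⟨ Δ≡ ⟩
    δ * E + δ * δ * S                   ≡⟨ cong (λ e → δ * e + δ * δ * S) E≡ ⟩
    δ * (T + a * (+ 2 * T)) + δ * δ * S ≡⟨ cong expanded N≡TM ⟩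
    expanded (T * M)                    ≡⟨ factor T M a S ⟩
    + 32 * (T * T * T) * q              ≡⟨ cong (_* q) (2^[2+3[1+v]] v) ⟨
    (+ 2) ^ (2 ℕ.+ 3 ℕ.* suc v) * q     ∎)
    where
    n = 2 ℕ.^ v ℕ.* m
    S = proj₁ (Δ-even-expansion n)
    Δ≡ = proj₂ (Δ-even-expansion n)
    N = + n
    M = + m
    T = (+ 2) ^ v
    N≡TM : N ≡ T * M
    N≡TM = trans (pos-* (2 ℕ.^ v) m) (cong (_* M) (pos-^ 2 v))
    E = prod′ (oddSquareGap (+ 2 * N)) n
    δ = + 32 * (N * N)
    E-mod : E ≡ T mod (+ 2) ^ suc v
    E-mod = prod′-dyadic (oddSquareGap-odd (mod-trans (mod-reflexive (*-comm (+ 2) N)) (double-even N)))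
                         m-odd (oddSquareGap-shift (+ 2 * N)) v
    open _≡_mod_ E-mod renaming (quotient to a; equation to E≡)
    expanded : ℤ → ℤ
    expanded z = + 32 * (z * z) * (T + a * (+ 2 * T)) + + 32 * (z * z) * (+ 32 * (z * z)) * S
    1+2a-odd : Odd (+ 1 + a * + 2)
    1+2a-odd = a , refl
    e = + 16 * T * (M * M * M * M) * S
    q = M * M * (+ 1 + a * + 2) + e * + 2
    q-odd : Odd q
    q-odd = mod-+ (mod-* (mod-* (Oddℕ⇒Odd m-odd) (Oddℕ⇒Odd m-odd)) 1+2a-odd) (double-even e)
    factor : ∀ T M a S → + 32 * ((T * M) * (T * M)) * (T + a * (+ 2 * T))
                          + + 32 * ((T * M) * (T * M)) * (+ 32 * ((T * M) * (T * M))) * S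
                        ≡ + 32 * (T * T * T) * (M * M * (+ 1 + a * + 2) + + 16 * T * (M * M * M * M) * S * + 2)
    factor = solve-∀

  Δ-valuation : ∀ k {m} → Oddℕ m → Δ (2 ℕ.^ k ℕ.* m) =2^ 2 ℕ.+ 3 ℕ.* k ·odd
  Δ-valuation zero {m} (j , m≡1+2j) = subst (λ d → Δ d =2^ 2 ·odd) (sym 1*m≡1+[j+j]) (Δ-odd j)
    where
    1*m≡1+[j+j] : 1 ℕ.* m ≡ suc (j ℕ.+ j)
    1*m≡1+[j+j] = trans (ℕP.*-identityˡ m) (trans m≡1+2j (cong (λ t → suc (j ℕ.+ t)) (ℕP.+-identityʳ j)))
  Δ-valuation (suc v) {m} m-odd =
    subst (λ d → Δ d =2^ 2 ℕ.+ 3 ℕ.* suc v ·odd) (sym (double-2^* v m)) (Δ-even v m-odd)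

  valuation-transfer : ∀ {A B U O Ω s e E} {σ : ℤ} → Oddℕ Ω →
                       2 ℕ.* A ℕ.* Ω ≡ 2 ℕ.^ s ℕ.* U → 2 ℕ.* B ℕ.* Ω ≡ 2 ℕ.^ s ℕ.* O →
                       + U - σ * + O =2^ e ·odd → s ℕ.+ e ≡ suc E → (+ A - σ * + B) HasV₂ E
  valuation-transfer {A} {B} {U} {O} {Ω} {s} {e} {E} {σ} Ω-odd AΩ≡ BΩ≡ (q , q-odd , Δ≡) s+e≡1+E =
    HasV₂-intro {e = E} Ω-odd (q , q-odd , *-cancelˡ-≡ (+ 2) _ _ (begin
      + 2 * (+ Ω * (+ A - σ * + B))           ≡⟨ distribute (+ A) (+ B) (+ Ω) σ ⟩
      + 2 * + A * + Ω - σ * (+ 2 * + B * + Ω) ≡⟨ cong₂ (λ a b → a - σ * b) (cast {A} {U} AΩ≡) (cast {B} {O} BΩ≡) ⟩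
      (+ 2) ^ s * + U - σ * ((+ 2) ^ s * + O) ≡⟨ factor ((+ 2) ^ s) (+ U) (+ O) σ ⟩
      (+ 2) ^ s * (+ U - σ * + O)             ≡⟨ cong ((+ 2) ^ s *_) Δ≡ ⟩
      (+ 2) ^ s * ((+ 2) ^ e * q)             ≡⟨ *-assoc ((+ 2) ^ s) ((+ 2) ^ e) q ⟨
      (+ 2) ^ s * (+ 2) ^ e * q               ≡⟨ cong (_* q) (^-distribˡ-+-* (+ 2) s e) ⟨
      (+ 2) ^ (s ℕ.+ e) * q                   ≡⟨ cong (λ t → (+ 2) ^ t * q) s+e≡1+E ⟩
      + 2 * (+ 2) ^ E * q                     ≡⟨ *-assoc (+ 2) ((+ 2) ^ E) q ⟩
      + 2 * ((+ 2) ^ E * q)                   ∎))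
    where
    cast : ∀ {x y} → 2 ℕ.* x ℕ.* Ω ≡ 2 ℕ.^ s ℕ.* y → + 2 * + x * + Ω ≡ (+ 2) ^ s * + y
    cast {x} {y} eq = begin
      + 2 * + x * + Ω    ≡⟨ cong (_* + Ω) (pos-* 2 x) ⟨
      + (2 ℕ.* x) * + Ω  ≡⟨ pos-* (2 ℕ.* x) Ω ⟨
      + (2 ℕ.* x ℕ.* Ω)  ≡⟨ cong +_ eq ⟩
      + (2 ℕ.^ s ℕ.* y)  ≡⟨ pos-* (2 ℕ.^ s) y ⟩
      + (2 ℕ.^ s) * + y  ≡⟨ cong (_* + y) (pos-^ 2 s) ⟩
      (+ 2) ^ s * + y    ∎
    distribute : ∀ a b w σ → + 2 * (w * (a - σ * b)) ≡ + 2 * a * w - σ * (+ 2 * b * w)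
    distribute = solve-∀
    factor : ∀ t u o σ → t * u - σ * (t * o) ≡ t * (u - σ * o)
    factor = solve-∀

open import Data.Nat using (ℕ; suc; _+_; _*_; _∸_; _^_; _≤_)
open import Data.Nat.Properties using (+-comm)
open import Data.Nat.Combinatorics using (_C_)
open import Data.Nat.Tactic.RingSolver using (solve-∀)
open import Data.Integer as ℤ using (ℤ)
open Binary using (odd-part; s₂-pred)
open Factorials using (binomials-oddProd)
open OddProducts using (Δ-valuation; valuation-transfer)

lemmaC2 : (d : ℕ) → 1 ≤ d → (k : ℕ) → (ℤ.+ d) HasV₂ k →
    (ℤ.+ ((4 * d ∸ 1) C (2 * d ∸ 1)) ℤ.- negOnePow d ℤ.* ℤ.+ ((2 * d ∸ 1) C (d ∸ 1)))
    HasV₂ (2 + 2 * k + s₂ (d ∸ 1))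
lemmaC2 d 1≤d k (2^k∣d , 2^[1+k]∤d) with odd-part k 2^k∣d 2^[1+k]∤d
... | m , m-odd , refl with binomials-oddProd (2 ^ k * m) 1≤d
... | Ω , Ω-odd , upper , lower =
  valuation-transfer {A = (4 * n ∸ 1) C (2 * n ∸ 1)} {B = (2 * n ∸ 1) C (n ∸ 1)}
                     {s = s₂ n} {e = 2 + 3 * k} {σ = negOnePow n}
                     Ω-odd upper lower (Δ-valuation k m-odd) exponent
  where
  open ≡-Reasoning
  n = 2 ^ k * m
  exponent : s₂ n + (2 + 3 * k) ≡ suc (2 + 2 * k + s₂ (n ∸ 1))
  exponent = begin
    s₂ n + (2 + 3 * k)             ≡⟨ regroup (s₂ n) k ⟩
    s₂ n + k + (2 + 2 * k)         ≡⟨ cong (_+ (2 + 2 * k)) (s₂-pred k m-odd) ⟨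
    suc (s₂ (n ∸ 1)) + (2 + 2 * k) ≡⟨ cong suc (+-comm (s₂ (n ∸ 1)) (2 + 2 * k)) ⟩
    suc (2 + 2 * k + s₂ (n ∸ 1))   ∎
    where
    regroup : ∀ s k → s + (2 + 3 * k) ≡ s + k + (2 + 2 * k)
    regroup = solve-∀
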